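{- Let $P$ be a non-empty set and $\mathcal{L}$ a set of formulae with semantic function $[\![\cdot]\!]:\mathcal{L}\to\mathcal{P}(P)$ such that $\mathcal{L}(p)\neq\emptyset$ for every $p\in P$. If $\mathcal{L}$ is decomposable, then every formula in $\mathcal{L}$ that is consistent and prime is characteristic for some $p\in P$.
   Context: For $p\in P$, $\mathcal{L}(p)=\{\phi\in\mathcal{L}\mid p\in[\![\phi]\!]\}$. A formula $\phi$ is consistent iff $[\![\phi]\!]\neq\emptyset$. A formula $\phi$ is characteristic for $p$ iff for all $q\in P$: $q\in[\![\phi]\!]$ iff $\mathcal{L}(p)\subseteq\mathcal{L}(q)$; such a formula, when it exists, is denoted $\chi(p)$ (it is unique up to having the same denotation). A formula $\phi$ is prime iff for every non-empty finite $\Psi\subseteq\mathcal{L}$, $[\![\phi]\!]\subseteq\bigcup_{\psi\in\Psi}[\![\psi]\!]$ implies $[\![\phi]\!]\subseteq[\![\psi]\!]$ for some $\psi\in\Psi$. A formula $\phi$ is decomposable iff $[\![\phi]\!]=[\![\chi(p)]\!]\cup[\![\psi_p]\!]$ for some $p\in P$ having a characteristic formula $\chi(p)$ and some $\psi_p\in\mathcal{L}$ with $p\notin[\![\psi_p]\!]$. The logic $\mathcal{L}$ is decomposable iff every consistent formula of $\mathcal{L}$ is decomposable or characteristic for some $p\in P$. -}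

module Defs where

open import Level using (Level; _⊔_; suc)
open import Data.Product using (Σ; _×_; ∃)
open import Data.Sum using (_⊎_)
open import Data.List.NonEmpty using (List⁺; toList)
open import Data.List.Relation.Unary.Any using (Any)
open import Relation.Nullary using (¬_)
open import Function.Bundles using (_⇔_)

-- A logic: a set P of processes, a set L of formulae, and a semantic
-- function ⟦_⟧ : L → 𝒫(P), with subsets of P represented as predicates.
module Logic {a b ℓ : Level} (P : Set a) (L : Set b) (⟦_⟧ : L → P → Set ℓ) where

  𝓛 : P → L → Set ℓ
  𝓛 p φ = ⟦ φ ⟧ p

  _⊑_ : L → L → Set (a ⊔ ℓ)
  φ ⊑ ψ = ∀ q → ⟦ φ ⟧ q → ⟦ ψ ⟧ q

  _≼_ : P → P → Set (b ⊔ ℓ)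
  p ≼ q = ∀ φ → 𝓛 p φ → 𝓛 q φ

  Consistent : L → Set (a ⊔ ℓ)
  Consistent φ = ∃ λ q → ⟦ φ ⟧ q

  CharacteristicFor : L → P → Set (a ⊔ b ⊔ ℓ)
  CharacteristicFor φ p = ∀ q → (⟦ φ ⟧ q ⇔ (p ≼ q))

  Prime : L → Set (a ⊔ b ⊔ ℓ)
  Prime φ = (Ψ : List⁺ L) →
            (∀ q → ⟦ φ ⟧ q → Any (λ ψ → ⟦ ψ ⟧ q) (toList Ψ)) →
            Any (λ ψ → φ ⊑ ψ) (toList Ψ)

  Decomposable : L → Set (a ⊔ b ⊔ ℓ)
  Decomposable φ =
    Σ P λ p → Σ L λ χp → Σ L λ ψp →
      CharacteristicFor χp p × ¬ ⟦ ψp ⟧ p ×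
      (∀ q → (⟦ φ ⟧ q ⇔ (⟦ χp ⟧ q ⊎ ⟦ ψp ⟧ q)))

  DecomposableLogic : Set (a ⊔ b ⊔ ℓ)
  DecomposableLogic = ∀ φ → Consistent φ →
                      Decomposable φ ⊎ (Σ P λ p → CharacteristicFor φ p)

{-# OPTIONS --safe #-}
-- A decomposition ⟦φ⟧ = ⟦χ(p)⟧ ∪ ⟦ψ_p⟧ is a cover of ⟦φ⟧ by two formulae, so a
-- prime φ is contained in one of them. It cannot be ⟦ψ_p⟧, because p ∈ ⟦χ(p)⟧ ⊆ ⟦φ⟧
-- while p ∉ ⟦ψ_p⟧; hence ⟦φ⟧ = ⟦χ(p)⟧ and φ is characteristic for p.
module Submission where

open import Defs
open import Level using (Level)
open import Data.Product using (Σ; ∃; _,_)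
open import Data.Sum using (_⊎_; inj₁; inj₂; [_,_])
open import Data.List.NonEmpty using (_∷_)
open import Data.List using ([]; _∷_)
open import Data.List.Relation.Unary.Any using (Any; here; there)
open import Data.Empty using (⊥-elim)
open import Function using (id)
open import Function.Bundles using (mk⇔; Equivalence)

module Primality {a b ℓ : Level} {P : Set a} {L : Set b} (⟦_⟧ : L → P → Set ℓ) where

  open Logic P L ⟦_⟧
  open Equivalence

  characteristic⇒holds : ∀ {χ p} → CharacteristicFor χ p → ⟦ χ ⟧ p
  characteristic⇒holds {p = p} χ-char = from (χ-char p) (λ _ φ∈𝓛p → φ∈𝓛p)

  characteristic-resp-⊑⊒ : ∀ {χ φ p} → CharacteristicFor χ p →
                           φ ⊑ χ → χ ⊑ φ → CharacteristicFor φ p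
  characteristic-resp-⊑⊒ χ-char φ⊑χ χ⊑φ q =
    mk⇔ (λ φq → to (χ-char q) (φ⊑χ q φq)) (λ p≼q → χ⊑φ q (from (χ-char q) p≼q))

  prime-⊎ : ∀ {φ ψ₁ ψ₂} → Prime φ →
            (∀ q → ⟦ φ ⟧ q → ⟦ ψ₁ ⟧ q ⊎ ⟦ ψ₂ ⟧ q) → φ ⊑ ψ₁ ⊎ φ ⊑ ψ₂
  prime-⊎ {ψ₁ = ψ₁} {ψ₂} φ-prime cover =
    Any₂⇒⊎ (φ-prime (ψ₁ ∷ ψ₂ ∷ []) (λ q φq → ⊎⇒Any₂ (cover q φq)))
    where
    ⊎⇒Any₂ : ∀ {r} {Q : L → Set r} → Q ψ₁ ⊎ Q ψ₂ → Any Q (ψ₁ ∷ ψ₂ ∷ [])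
    ⊎⇒Any₂ = [ here , (λ Qψ₂ → there (here Qψ₂)) ]
    Any₂⇒⊎ : ∀ {r} {Q : L → Set r} → Any Q (ψ₁ ∷ ψ₂ ∷ []) → Q ψ₁ ⊎ Q ψ₂
    Any₂⇒⊎ (here Qψ₁)         = inj₁ Qψ₁
    Any₂⇒⊎ (there (here Qψ₂)) = inj₂ Qψ₂

  prime∧decomposable⇒characteristic : ∀ {φ} → Prime φ → Decomposable φ →
                                      Σ P (CharacteristicFor φ)
  prime∧decomposable⇒characteristic {φ} φ-prime (p , χ , ψ , χ-char , p∉ψ , φ≐χ∪ψ) =
    [ (λ φ⊑χ → p , characteristic-resp-⊑⊒ χ-char φ⊑χ χ⊑φ)
    , (λ φ⊑ψ → ⊥-elim (p∉ψ (φ⊑ψ p (χ⊑φ p (characteristic⇒holds χ-char)))))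
    ] (prime-⊎ φ-prime (λ q → to (φ≐χ∪ψ q)))
    where
    χ⊑φ : χ ⊑ φ
    χ⊑φ q χq = from (φ≐χ∪ψ q) (inj₁ χq)

mainTheorem2 : {a b ℓ : Level} (P : Set a) (L : Set b) (⟦_⟧ : L → P → Set ℓ) →
    P →
    (∀ p → ∃ λ φ → Logic.𝓛 P L ⟦_⟧ p φ) →
    Logic.DecomposableLogic P L ⟦_⟧ →
    ∀ φ → Logic.Consistent P L ⟦_⟧ φ → Logic.Prime P L ⟦_⟧ φ →
    Σ P λ p → Logic.CharacteristicFor P L ⟦_⟧ φ p
mainTheorem2 P L ⟦_⟧ _ _ L-decomposable φ φ-consistent φ-prime =
  [ Primality.prime∧decomposable⇒characteristic ⟦_⟧ φ-prime , id ]
    (L-decomposable φ φ-consistent)
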